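{- Let $m$ be a positive integer and $K\subset K_3^m$ a code. Then $K$ is self-orthogonal if and only if $C_A(K)$ is self-orthogonal.
   Context: Codes over $\mathbb{F}_3$ are subspaces of $\mathbb{F}_3^n$ with the standard dot product; self-orthogonal means $C\subset C^\perp$. Let $d_3=\langle(1,1,1)\rangle\subset\mathbb{F}_3^3$ and $K_3=\langle(1,2,0)\rangle\subset\mathbb{F}_3^3$, and regard $d_3^m$ and $K_3^m$ as subspaces of $\mathbb{F}_3^{3m}$ (blockwise). A code of $K_3^m$ means a subspace $K\subset K_3^m$. Construction A: $C_A(K)=K+d_3^m\subset\mathbb{F}_3^{3m}$. -}

module Defs where

open import Data.Nat using (ℕ; zero; suc)
open import Data.Fin using (Fin; zero; suc)
open import Data.Product using (Σ; ∃; _×_; _,_)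
open import Relation.Binary.PropositionalEquality using (_≡_)
open import Relation.Unary using (Pred; _⊆_; _∈_)
open import Level using (0ℓ)

𝔽₃ : Set
𝔽₃ = Fin 3

pattern 𝟘 = zero
pattern 𝟙 = suc zero
pattern 𝟚 = suc (suc zero)

infixl 6 _⊕_
infixl 7 _⊗_

_⊕_ : 𝔽₃ → 𝔽₃ → 𝔽₃
𝟘 ⊕ y = y
𝟙 ⊕ 𝟘 = 𝟙
𝟙 ⊕ 𝟙 = 𝟚
𝟙 ⊕ 𝟚 = 𝟘
𝟚 ⊕ 𝟘 = 𝟚
𝟚 ⊕ 𝟙 = 𝟘
𝟚 ⊕ 𝟚 = 𝟙

_⊗_ : 𝔽₃ → 𝔽₃ → 𝔽₃
𝟘 ⊗ y = 𝟘
𝟙 ⊗ y = y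
𝟚 ⊗ 𝟘 = 𝟘
𝟚 ⊗ 𝟙 = 𝟚
𝟚 ⊗ 𝟚 = 𝟙

Σ𝔽 : (n : ℕ) → (Fin n → 𝔽₃) → 𝔽₃
Σ𝔽 zero    f = 𝟘
Σ𝔽 (suc n) f = f zero ⊕ Σ𝔽 n (λ i → f (suc i))

-- A word of F_3^{3m}, indexed blockwise: coordinate (i , j) is the
-- j-th coordinate of the i-th block of length 3.
Word : ℕ → Set
Word m = Fin m → Fin 3 → 𝔽₃

zeroW : ∀ {m} → Word m
zeroW i j = 𝟘

_+W_ : ∀ {m} → Word m → Word m → Word m
(x +W y) i j = x i j ⊕ y i j

_·W_ : ∀ {m} → 𝔽₃ → Word m → Word m
(a ·W x) i j = a ⊗ x i j

dot : ∀ {m} → Word m → Word m → 𝔽₃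
dot {m} x y = Σ𝔽 m (λ i → Σ𝔽 3 (λ j → x i j ⊗ y i j))

Code : ℕ → Set₁
Code m = Pred (Word m) 0ℓ

record IsSubspace {m : ℕ} (C : Code m) : Set where
  field
    zero-mem : zeroW ∈ C
    +-closed : ∀ {x y} → x ∈ C → y ∈ C → (x +W y) ∈ C
    ·-closed : ∀ a {x} → x ∈ C → (a ·W x) ∈ C

SelfOrthogonal : ∀ {m} → Code m → Set
SelfOrthogonal C = ∀ x y → x ∈ C → y ∈ C → dot x y ≡ 𝟘

-- d_3^m: blockwise span of (1,1,1), i.e. words constant on each block.
d₃^ : (m : ℕ) → Code m
d₃^ m z = Σ (Fin m → 𝔽₃) λ c → ∀ i j → z i j ≡ c i

k₃ : Fin 3 → 𝔽₃
k₃ 𝟘 = 𝟙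
k₃ 𝟙 = 𝟚
k₃ 𝟚 = 𝟘

K₃^ : (m : ℕ) → Code m
K₃^ m z = Σ (Fin m → 𝔽₃) λ c → ∀ i j → z i j ≡ c i ⊗ k₃ j

C-A : ∀ {m} → Code m → Code m
C-A {m} K z = ∃ λ k → ∃ λ d → k ∈ K × d ∈ d₃^ m × (∀ i j → z i j ≡ k i j ⊕ d i j)

{-# OPTIONS --safe #-}
module Submission where

-- Blockwise, (1,2,0)·(1,1,1) = 1 + 2 = 0 and (1,1,1)·(1,1,1) = 3 = 0,
-- so d₃^m is self-orthogonal and orthogonal to K₃^m.  By bilinearity of the
-- dot product, (k + d)·(k' + d') = k·k' for k, k' ∈ K₃^m and d, d' ∈ d₃^m;
-- conversely K ⊆ C_A(K).

open import Defs
open import Data.Nat using (ℕ; _≥_; zero; suc)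
open import Data.Fin using (Fin)
open import Data.Fin.Properties using (all?; _≟_)
open import Data.Product using (∃; _×_; _,_)
open import Function.Bundles using (_⇔_; mk⇔)
open import Relation.Binary.PropositionalEquality using (_≡_; refl; sym; trans; cong₂; module ≡-Reasoning)
open import Relation.Nullary.Decidable using (from-yes)
open import Relation.Unary using (_⊆_; _∈_)

⊕-identityʳ : ∀ a → a ⊕ 𝟘 ≡ a
⊕-identityʳ = from-yes (all? λ a → a ⊕ 𝟘 ≟ a)

⊕-interchange : ∀ a b c d → (a ⊕ b) ⊕ (c ⊕ d) ≡ (a ⊕ c) ⊕ (b ⊕ d)
⊕-interchange = from-yes (all? λ a → all? λ b → all? λ c → all? λ d →
  (a ⊕ b) ⊕ (c ⊕ d) ≟ (a ⊕ c) ⊕ (b ⊕ d))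

⊗-comm : ∀ a b → a ⊗ b ≡ b ⊗ a
⊗-comm = from-yes (all? λ a → all? λ b → a ⊗ b ≟ b ⊗ a)

⊗-distribʳ-⊕ : ∀ a b c → (b ⊕ c) ⊗ a ≡ b ⊗ a ⊕ c ⊗ a
⊗-distribʳ-⊕ = from-yes (all? λ a → all? λ b → all? λ c → (b ⊕ c) ⊗ a ≟ b ⊗ a ⊕ c ⊗ a)

Σ𝔽-cong : ∀ n {f g : Fin n → 𝔽₃} → (∀ i → f i ≡ g i) → Σ𝔽 n f ≡ Σ𝔽 n g
Σ𝔽-cong zero    f≡g = refl
Σ𝔽-cong (suc n) f≡g = cong₂ _⊕_ (f≡g Fin.zero) (Σ𝔽-cong n (λ i → f≡g (Fin.suc i)))

Σ𝔽-zero : ∀ n {f : Fin n → 𝔽₃} → (∀ i → f i ≡ 𝟘) → Σ𝔽 n f ≡ 𝟘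
Σ𝔽-zero zero    f≡𝟘 = refl
Σ𝔽-zero (suc n) f≡𝟘 = cong₂ _⊕_ (f≡𝟘 Fin.zero) (Σ𝔽-zero n (λ i → f≡𝟘 (Fin.suc i)))

Σ𝔽-⊕ : ∀ n (f g : Fin n → 𝔽₃) → Σ𝔽 n (λ i → f i ⊕ g i) ≡ Σ𝔽 n f ⊕ Σ𝔽 n g
Σ𝔽-⊕ zero    f g = refl
Σ𝔽-⊕ (suc n) f g = begin
  (f Fin.zero ⊕ g Fin.zero) ⊕ Σ𝔽 n (λ i → f (Fin.suc i) ⊕ g (Fin.suc i))
    ≡⟨ cong₂ _⊕_ refl (Σ𝔽-⊕ n (λ i → f (Fin.suc i)) (λ i → g (Fin.suc i))) ⟩
  (f Fin.zero ⊕ g Fin.zero) ⊕ (Σ𝔽 n (λ i → f (Fin.suc i)) ⊕ Σ𝔽 n (λ i → g (Fin.suc i)))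
    ≡⟨ ⊕-interchange (f Fin.zero) (g Fin.zero) (Σ𝔽 n (λ i → f (Fin.suc i))) (Σ𝔽 n (λ i → g (Fin.suc i))) ⟩
  Σ𝔽 (suc n) f ⊕ Σ𝔽 (suc n) g ∎
  where open ≡-Reasoning

characteristic-3 : ∀ a → Σ𝔽 3 (λ _ → a) ≡ 𝟘
characteristic-3 = from-yes (all? λ a → Σ𝔽 3 (λ _ → a) ≟ 𝟘)

k₃-orthogonal-constant : ∀ c e → Σ𝔽 3 (λ j → c ⊗ k₃ j ⊗ e) ≡ 𝟘
k₃-orthogonal-constant = from-yes (all? λ c → all? λ e → Σ𝔽 3 (λ j → c ⊗ k₃ j ⊗ e) ≟ 𝟘)

module _ {m : ℕ} where

  _≈W_ : Word m → Word m → Set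
  x ≈W y = ∀ i j → x i j ≡ y i j

  dot-cong : ∀ {x x′ y y′ : Word m} → x ≈W x′ → y ≈W y′ → dot x y ≡ dot x′ y′
  dot-cong x≈x′ y≈y′ = Σ𝔽-cong m λ i → Σ𝔽-cong 3 λ j → cong₂ _⊗_ (x≈x′ i j) (y≈y′ i j)

  dot-blockwise-zero : ∀ (x y : Word m) → (∀ i → Σ𝔽 3 (λ j → x i j ⊗ y i j) ≡ 𝟘) → dot x y ≡ 𝟘
  dot-blockwise-zero x y = Σ𝔽-zero m

  dot-comm : ∀ (x y : Word m) → dot x y ≡ dot y x
  dot-comm x y = Σ𝔽-cong m λ i → Σ𝔽-cong 3 λ j → ⊗-comm (x i j) (y i j)

  dot-distribˡ-+W : ∀ (x y z : Word m) → dot (x +W y) z ≡ dot x z ⊕ dot y z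
  dot-distribˡ-+W x y z = trans
    (Σ𝔽-cong m λ i → trans (Σ𝔽-cong 3 λ j → ⊗-distribʳ-⊕ (z i j) (x i j) (y i j)) (Σ𝔽-⊕ 3 (λ j → x i j ⊗ z i j) (λ j → y i j ⊗ z i j)))
    (Σ𝔽-⊕ m (λ i → Σ𝔽 3 λ j → x i j ⊗ z i j) (λ i → Σ𝔽 3 λ j → y i j ⊗ z i j))

  dot-distribʳ-+W : ∀ (x y z : Word m) → dot x (y +W z) ≡ dot x y ⊕ dot x z
  dot-distribʳ-+W x y z = begin
    dot x (y +W z)        ≡⟨ dot-comm x (y +W z) ⟩
    dot (y +W z) x        ≡⟨ dot-distribˡ-+W y z x ⟩
    dot y x ⊕ dot z x     ≡⟨ cong₂ _⊕_ (dot-comm y x) (dot-comm z x) ⟩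
    dot x y ⊕ dot x z     ∎
    where open ≡-Reasoning

  Orthogonal : Code m → Code m → Set
  Orthogonal C D = ∀ x y → x ∈ C → y ∈ D → dot x y ≡ 𝟘

  _+ᶜ_ : Code m → Code m → Code m
  (C +ᶜ D) z = ∃ λ x → ∃ λ y → x ∈ C × y ∈ D × (z ≈W (x +W y))

  ⊆-+ᶜ : ∀ {C D : Code m} → zeroW ∈ D → C ⊆ C +ᶜ D
  ⊆-+ᶜ 0∈D {x} x∈C = x , zeroW , x∈C , 0∈D , λ i j → sym (⊕-identityʳ (x i j))

  selfOrthogonal-⊆ : ∀ {C D : Code m} → C ⊆ D → SelfOrthogonal D → SelfOrthogonal C
  selfOrthogonal-⊆ C⊆D soD x y x∈C y∈C = soD x y (C⊆D x∈C) (C⊆D y∈C)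

  +ᶜ-selfOrthogonal : ∀ {C D : Code m} → SelfOrthogonal C → SelfOrthogonal D → Orthogonal C D →
                      SelfOrthogonal (C +ᶜ D)
  +ᶜ-selfOrthogonal soC soD C⊥D z w (x , y , x∈C , y∈D , z≈x+y) (x′ , y′ , x′∈C , y′∈D , w≈x′+y′) = begin
    dot z w
      ≡⟨ dot-cong z≈x+y w≈x′+y′ ⟩
    dot (x +W y) (x′ +W y′)
      ≡⟨ dot-distribˡ-+W x y (x′ +W y′) ⟩
    dot x (x′ +W y′) ⊕ dot y (x′ +W y′)
      ≡⟨ cong₂ _⊕_ (dot-distribʳ-+W x x′ y′) (dot-distribʳ-+W y x′ y′) ⟩
    (dot x x′ ⊕ dot x y′) ⊕ (dot y x′ ⊕ dot y y′)
      ≡⟨ cong₂ _⊕_ (cong₂ _⊕_ (soC x x′ x∈C x′∈C) (C⊥D x y′ x∈C y′∈D))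
                   (cong₂ _⊕_ (trans (dot-comm y x′) (C⊥D x′ y x′∈C y∈D)) (soD y y′ y∈D y′∈D)) ⟩
    𝟘 ∎
    where open ≡-Reasoning

zeroW∈d₃ : ∀ m → zeroW ∈ d₃^ m
zeroW∈d₃ m = (λ _ → 𝟘) , λ i j → refl

d₃-selfOrthogonal : ∀ m → SelfOrthogonal (d₃^ m)
d₃-selfOrthogonal m x y (c , x≡c) (c′ , y≡c′) = dot-blockwise-zero x y λ i →
  trans (Σ𝔽-cong 3 λ j → cong₂ _⊗_ (x≡c i j) (y≡c′ i j)) (characteristic-3 (c i ⊗ c′ i))

K₃⊥d₃ : ∀ m → Orthogonal (K₃^ m) (d₃^ m)
K₃⊥d₃ m x y (c , x≡ck₃) (e , y≡e) = dot-blockwise-zero x y λ i →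
  trans (Σ𝔽-cong 3 λ j → cong₂ _⊗_ (x≡ck₃ i j) (y≡e i j)) (k₃-orthogonal-constant (c i) (e i))

proposition4p2 : (m : ℕ) → m ≥ 1 → (K : Code m) → IsSubspace K → K ⊆ K₃^ m →
    (SelfOrthogonal K ⇔ SelfOrthogonal (C-A K))
proposition4p2 m _ K _ K⊆K₃ = mk⇔
  (λ soK → +ᶜ-selfOrthogonal soK (d₃-selfOrthogonal m) (λ x y x∈K → K₃⊥d₃ m x y (K⊆K₃ x∈K)))
  (selfOrthogonal-⊆ (⊆-+ᶜ (zeroW∈d₃ m)))
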